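{- For every positive integer $k$, the number of pairwise non-isomorphic graphs $G$ with $D(G)\le k$ does not exceed $\mathit{Tower}(k+\log^*k+2)$.
   Context: Graphs are finite, simple, undirected, with non-empty vertex set. First-order sentences about graphs have variables ranging over vertices, relation symbols $\sim$ (adjacency) and $=$ (equality), Boolean connectives and quantifiers $\exists,\forall$. The quantifier depth of a sentence is the maximum length of a chain of nested quantifiers. A sentence defines a graph $G$ if it is true on $G$ and false on every graph not isomorphic to $G$. $D(G)$ is the minimum quantifier depth of a sentence defining $G$. $\mathit{Tower}(0)=1$, $\mathit{Tower}(i)=2^{\mathit{Tower}(i-1)}$; $\log^*n=\min\{i:\mathit{Tower}(i)\ge n\}$. -}

module Defs where

open import Data.Nat using (ℕ; zero; suc; _+_; _^_; _≤_; _≤?_)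
open import Data.Fin using (Fin; _≟_)
open import Data.Bool using (Bool; true; false; not; _∧_; _∨_)
open import Data.List using (List; allFin)
open import Data.Bool.ListAction using (any; all)
open import Data.List.Relation.Unary.All using (All)
open import Data.List.Relation.Unary.AllPairs using (AllPairs)
open import Data.Product using (Σ; _×_)
open import Function.Bundles using (_↔_; Inverse)
open import Relation.Nullary using (¬_; yes; no)
open import Relation.Nullary.Decidable using (⌊_⌋)
open import Relation.Binary.PropositionalEquality using (_≡_)

record Graph : Set where
  field
    n        : ℕ
    nonempty : 1 ≤ n
    adj      : Fin n → Fin n → Bool
    symm     : ∀ u v → adj u v ≡ adj v u
    irrefl   : ∀ v → adj v v ≡ false
open Graph public

_≅_ : Graph → Graph → Set
G ≅ H = Σ (Fin (n G) ↔ Fin (n H)) λ f →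
          ∀ u v → adj G u v ≡ adj H (Inverse.to f u) (Inverse.to f v)

-- First-order formulas in the language {∼, =}, with de Bruijn variables:
-- a Formula v has free variables among Fin v.
data Formula (v : ℕ) : Set where
  Adj    : Fin v → Fin v → Formula v
  Eq     : Fin v → Fin v → Formula v
  Not    : Formula v → Formula v
  And    : Formula v → Formula v → Formula v
  Or     : Formula v → Formula v → Formula v
  Imp    : Formula v → Formula v → Formula v
  Iff    : Formula v → Formula v → Formula v
  Exists : Formula (suc v) → Formula v
  Forall : Formula (suc v) → Formula v

Sentence : Set
Sentence = Formula 0

depth : ∀ {v} → Formula v → ℕ
depth (Adj _ _)   = 0
depth (Eq _ _)    = 0
depth (Not φ)     = depth φ
depth (And φ ψ)   = depth φ Data.Nat.⊔ depth ψ
depth (Or φ ψ)    = depth φ Data.Nat.⊔ depth ψ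
depth (Imp φ ψ)   = depth φ Data.Nat.⊔ depth ψ
depth (Iff φ ψ)   = depth φ Data.Nat.⊔ depth ψ
depth (Exists φ)  = suc (depth φ)
depth (Forall φ)  = suc (depth φ)

extend : ∀ {v} {A : Set} → A → (Fin v → A) → Fin (suc v) → A
extend a ρ Fin.zero    = a
extend a ρ (Fin.suc i) = ρ i

_⇔ᵇ_ : Bool → Bool → Bool
true  ⇔ᵇ b = b
false ⇔ᵇ b = not b

eval : (G : Graph) → ∀ {v} → Formula v → (Fin v → Fin (n G)) → Bool
eval G (Adj i j)  ρ = adj G (ρ i) (ρ j)
eval G (Eq i j)   ρ = ⌊ ρ i ≟ ρ j ⌋
eval G (Not φ)    ρ = not (eval G φ ρ)
eval G (And φ ψ)  ρ = eval G φ ρ ∧ eval G ψ ρ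
eval G (Or φ ψ)   ρ = eval G φ ρ ∨ eval G ψ ρ
eval G (Imp φ ψ)  ρ = not (eval G φ ρ) ∨ eval G ψ ρ
eval G (Iff φ ψ)  ρ = eval G φ ρ ⇔ᵇ eval G ψ ρ
eval G (Exists φ) ρ = any (λ a → eval G φ (extend a ρ)) (allFin (n G))
eval G (Forall φ) ρ = all (λ a → eval G φ (extend a ρ)) (allFin (n G))

noVars : ∀ {A : Set} → Fin 0 → A
noVars ()

_⊨_ : Graph → Sentence → Set
G ⊨ φ = eval G φ noVars ≡ true

Defines : Sentence → Graph → Set
Defines φ G = (G ⊨ φ) × (∀ H → ¬ (G ≅ H) → ¬ (H ⊨ φ))

D≤ : Graph → ℕ → Set
D≤ G k = Σ Sentence λ φ → (depth φ ≤ k) × Defines φ G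

Tower : ℕ → ℕ
Tower zero    = 1
Tower (suc i) = 2 ^ Tower i

-- log* m = min { i : Tower i ≥ m }, found by linear search from 0;
-- fuel m suffices since Tower i ≥ i for all i.
search : ℕ → ℕ → ℕ → ℕ
search m zero    i = i
search m (suc f) i with m ≤? Tower i
... | yes _ = i
... | no  _ = search m f (suc i)

logStar : ℕ → ℕ
logStar m = search m m 0

-- Give every v-tuple of vertices its k-type: the 0-type codes the atomic diagram
-- of the tuple (a symmetric matrix over adjacency × equality), and the (k+1)-type
-- codes the set of k-types of its one-point extensions. By a back-and-forth
-- argument, tuples with equal k-types satisfy the same formulas of depth ≤ k, so a
-- graph defined by a sentence of depth k is determined up to isomorphism by the
-- k-type of the empty tuple. There are at most a tower of k exponentials over
-- 4^(k choose 2) ≤ 2^2^k ≤ Tower (log* k + 2) such types.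
module Submission where

open import Defs
open import Data.Nat using (ℕ; zero; suc; _+_; _*_; _^_; _≤_; _<_; _≤?_; s≤s; z≤n)
open import Data.Nat.Properties
  using (≤-trans; +-mono-≤; *-mono-≤; *-monoʳ-≤; ^-monoʳ-≤; m^n>0; ^-*-assoc; ^-distribˡ-+-*;
         +-identityʳ; +-suc; +-comm; +-assoc; m⊔n≤o⇒m≤o; m⊔n≤o⇒n≤o; module ≤-Reasoning)
open import Data.Fin using (Fin; _≟_; combine; funToFin; finToFun; fromℕ<) renaming (zero to 0F; suc to fsuc)
open import Data.Fin.Properties using (any?; combine-injective; combine-injectiveˡ; combine-injectiveʳ; finToFun-funToFin; injective⇒≤)
open import Data.Bool using (Bool; true; false; T; not; _∧_; _∨_)
open import Data.Bool.ListAction using (any; all)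
open import Data.List using (List; length; lookup; map; allFin)
open import Data.List.Properties using (length-map)
open import Data.List.Membership.Propositional using (lose)
open import Data.List.Membership.Propositional.Properties using (∈-allFin; ∈-lookup)
open import Data.List.Relation.Unary.All as All using (All; []; _∷_)
open import Data.List.Relation.Unary.All.Properties using (all⁺; all⁻)
open import Data.List.Relation.Unary.Any using (satisfied)
open import Data.List.Relation.Unary.Any.Properties using (any⁺; any⁻)
open import Data.List.Relation.Unary.AllPairs using (AllPairs; []; _∷_)
open import Data.List.Relation.Unary.AllPairs.Properties using (map⁺)
open import Data.Product using (_×_; _,_; proj₁; proj₂; ∃-syntax)
open import Data.Empty using (⊥-elim)
open import Relation.Nullary using (¬_; Dec; yes; no; does)
open import Relation.Nullary.Decidable using (⌊_⌋)
open import Relation.Binary.PropositionalEquality using (_≡_; _≢_; refl; sym; trans; cong; cong₂; subst)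

T-injective : ∀ {x y} → (T x → T y) → (T y → T x) → x ≡ y
T-injective {false} {false} _ _ = refl
T-injective {false} {true}  _ g = ⊥-elim (g _)
T-injective {true}  {false} f _ = ⊥-elim (f _)
T-injective {true}  {true}  _ _ = refl

bit : Bool → Fin 2
bit false = 0F
bit true  = fsuc 0F

bit-injective : ∀ {x y} → bit x ≡ bit y → x ≡ y
bit-injective {false} {false} _ = refl
bit-injective {true}  {true}  _ = refl

does-transfer : ∀ {P Q : Set} (p? : Dec P) (q? : Dec Q) → does p? ≡ does q? → P → Q
does-transfer (yes _) (yes q) _  _ = q
does-transfer (no ¬p) _       _  p = ⊥-elim (¬p p)

⌊≟⌋-refl : ∀ {m} (x : Fin m) → ⌊ x ≟ x ⌋ ≡ true
⌊≟⌋-refl x with x ≟ x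
... | yes _  = refl
... | no x≢x = ⊥-elim (x≢x refl)

⌊≟⌋-sym : ∀ {m} (x y : Fin m) → ⌊ x ≟ y ⌋ ≡ ⌊ y ≟ x ⌋
⌊≟⌋-sym x y with x ≟ y | y ≟ x
... | yes _   | yes _   = refl
... | no _    | no _    = refl
... | yes x≡y | no y≢x  = ⊥-elim (y≢x (sym x≡y))
... | no x≢y  | yes y≡x = ⊥-elim (x≢y (sym y≡x))

module _ {a b} {f : Fin a → Bool} {g : Fin b → Bool} where

  any-allFin-transfer : (∀ x → ∃[ y ] f x ≡ g y) → T (any f (allFin a)) → T (any g (allFin b))
  any-allFin-transfer forth Tany =
    let x , Tfx   = satisfied (any⁻ f (allFin a) Tany)
        y , fx≡gy = forth x
    in any⁺ g (lose (∈-allFin y) (subst T fx≡gy Tfx))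

  all-allFin-transfer : (∀ y → ∃[ x ] g y ≡ f x) → T (all f (allFin a)) → T (all g (allFin b))
  all-allFin-transfer back Tall = all⁻ g (All.tabulate {xs = allFin b} λ {y} _ → gTrue y)
    where
    gTrue : ∀ y → T (g y)
    gTrue y with x , gy≡fx ← back y =
      subst T (sym gy≡fx) (All.lookup (all⁺ f (allFin a) Tall) (∈-allFin x))

funToFin-injective : ∀ {m a} {f g : Fin m → Fin a} → funToFin f ≡ funToFin g → ∀ x → f x ≡ g x
funToFin-injective {f = f} {g} e x =
  trans (sym (finToFun-funToFin f x)) (trans (cong (λ c → finToFun c x) e) (finToFun-funToFin g x))

lookup-injective : ∀ {A : Set} {xs : List A} → AllPairs _≢_ xs → ∀ {i j} → lookup xs i ≡ lookup xs j → i ≡ j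
lookup-injective (_   ∷ _)  {0F}     {0F}     _ = refl
lookup-injective (x≢ ∷ _)  {0F}     {fsuc j} e = ⊥-elim (All.lookup x≢ (∈-lookup j) e)
lookup-injective (x≢ ∷ _)  {fsuc i} {0F}     e = ⊥-elim (All.lookup x≢ (∈-lookup i) (sym e))
lookup-injective (_   ∷ ds) {fsuc i} {fsuc j} e = cong fsuc (lookup-injective ds e)

distinct⇒length≤ : ∀ {m} {xs : List (Fin m)} → AllPairs _≢_ xs → length xs ≤ m
distinct⇒length≤ ds = injective⇒≤ (lookup-injective ds)

symMatrixCount : ℕ → ℕ → ℕ
symMatrixCount a zero    = 1
symMatrixCount a (suc v) = a ^ v * symMatrixCount a v

symMatrixCode : ∀ {a} v → (Fin v → Fin v → Fin a) → Fin (symMatrixCount a v)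
symMatrixCode zero    M = 0F
symMatrixCode (suc v) M =
  combine (funToFin λ j → M 0F (fsuc j)) (symMatrixCode v λ i j → M (fsuc i) (fsuc j))

Symmetric : ∀ {v a} → (Fin v → Fin v → Fin a) → Set
Symmetric M = ∀ i j → M i j ≡ M j i

symMatrixCode-injective : ∀ {a} v {M N : Fin v → Fin v → Fin a} → Symmetric M → Symmetric N →
  (∀ i → M i i ≡ N i i) → symMatrixCode v M ≡ symMatrixCode v N → ∀ i j → M i j ≡ N i j
symMatrixCode-injective {a} (suc v) {M} {N} symM symN diag e = entry
  where
  row : ∀ j → M 0F (fsuc j) ≡ N 0F (fsuc j)
  row = funToFin-injective (combine-injectiveˡ {m = a ^ v} _ _ _ _ e)
  lower : ∀ i j → M (fsuc i) (fsuc j) ≡ N (fsuc i) (fsuc j)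
  lower = symMatrixCode-injective v (λ i j → symM (fsuc i) (fsuc j)) (λ i j → symN (fsuc i) (fsuc j))
            (λ i → diag (fsuc i)) (combine-injectiveʳ {m = a ^ v} _ _ _ _ e)
  entry : ∀ i j → M i j ≡ N i j
  entry 0F       0F       = diag 0F
  entry 0F       (fsuc j) = row j
  entry (fsuc i) 0F       = trans (symM (fsuc i) 0F) (trans (row i) (symN 0F (fsuc i)))
  entry (fsuc i) (fsuc j) = lower i j

module _ (G : Graph) {v : ℕ} (ρ : Fin v → Fin (n G)) where

  atomicEntry : Fin v → Fin v → Fin 4
  atomicEntry i j = combine (bit (eval G (Adj i j) ρ)) (bit (eval G (Eq i j) ρ))

  atomicEntry-sym : Symmetric atomicEntry
  atomicEntry-sym i j = cong₂ (λ x y → combine (bit x) (bit y)) (symm G (ρ i) (ρ j)) (⌊≟⌋-sym (ρ i) (ρ j))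

  atomicEntry-diag : ∀ i → atomicEntry i i ≡ combine (bit false) (bit true)
  atomicEntry-diag i = cong₂ (λ x y → combine (bit x) (bit y)) (irrefl G (ρ i)) (⌊≟⌋-refl (ρ i))

atomicEntry-≡⇒eval-≡ : (G H : Graph) {v : ℕ} (ρ : Fin v → Fin (n G)) (σ : Fin v → Fin (n H)) (i j : Fin v) →
  atomicEntry G ρ i j ≡ atomicEntry H σ i j →
  (eval G (Adj i j) ρ ≡ eval H (Adj i j) σ) × (eval G (Eq i j) ρ ≡ eval H (Eq i j) σ)
atomicEntry-≡⇒eval-≡ G H ρ σ i j e =
  let adj≡ , eq≡ = combine-injective (bit (eval G (Adj i j) ρ)) (bit (eval G (Eq i j) ρ))
                                     (bit (eval H (Adj i j) σ)) (bit (eval H (Eq i j) σ)) e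
  in bit-injective adj≡ , bit-injective eq≡

typeCount : ℕ → ℕ → ℕ
typeCount zero    v = symMatrixCount 4 v
typeCount (suc k) v = 2 ^ typeCount k (suc v)

tp : (G : Graph) (k : ℕ) {v : ℕ} → (Fin v → Fin (n G)) → Fin (typeCount k v)
tp G zero    ρ = symMatrixCode _ (atomicEntry G ρ)
tp G (suc k) ρ = funToFin λ t → bit (does (any? λ a → tp G k (extend a ρ) ≟ t))

tp-suc-≡⇒forth : (G H : Graph) {k v : ℕ} {ρ : Fin v → Fin (n G)} {σ : Fin v → Fin (n H)} →
  tp G (suc k) ρ ≡ tp H (suc k) σ → ∀ a → ∃[ b ] tp G k (extend a ρ) ≡ tp H k (extend b σ)
tp-suc-≡⇒forth G H {k} {ρ = ρ} e a
  with b , tpH≡tpG ← does-transfer (any? _) (any? _)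
                       (bit-injective (funToFin-injective e (tp G k (extend a ρ)))) (a , refl)
  = b , sym tpH≡tpG

-- An atomic fact about ρ is an atomic fact about any one-point extension of ρ,
-- and the graph has a vertex to extend by.
tp-≡⇒atomicEntry-≡ : (G H : Graph) (k : ℕ) {v : ℕ} {ρ : Fin v → Fin (n G)} {σ : Fin v → Fin (n H)} →
  tp G k ρ ≡ tp H k σ → ∀ i j → atomicEntry G ρ i j ≡ atomicEntry H σ i j
tp-≡⇒atomicEntry-≡ G H zero {v} {ρ} {σ} e =
  symMatrixCode-injective v (atomicEntry-sym G ρ) (atomicEntry-sym H σ)
    (λ i → trans (atomicEntry-diag G ρ i) (sym (atomicEntry-diag H σ i))) e
tp-≡⇒atomicEntry-≡ G H (suc k) e i j
  with b , e′ ← tp-suc-≡⇒forth G H {k = k} e (fromℕ< (nonempty G))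
  = tp-≡⇒atomicEntry-≡ G H k e′ (fsuc i) (fsuc j)

mutual
  tp-≡⇒eval-≡ : (G H : Graph) (k : ℕ) {v : ℕ} {ρ : Fin v → Fin (n G)} {σ : Fin v → Fin (n H)}
    (φ : Formula v) → depth φ ≤ k → tp G k ρ ≡ tp H k σ → eval G φ ρ ≡ eval H φ σ
  tp-≡⇒eval-≡ G H k {ρ = ρ} {σ} (Adj i j) _ e =
    proj₁ (atomicEntry-≡⇒eval-≡ G H ρ σ i j (tp-≡⇒atomicEntry-≡ G H k e i j))
  tp-≡⇒eval-≡ G H k {ρ = ρ} {σ} (Eq i j) _ e =
    proj₂ (atomicEntry-≡⇒eval-≡ G H ρ σ i j (tp-≡⇒atomicEntry-≡ G H k e i j))
  tp-≡⇒eval-≡ G H k (Not φ) d e = cong not (tp-≡⇒eval-≡ G H k φ d e)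
  tp-≡⇒eval-≡ G H k (And φ ψ) d e =
    cong₂ _∧_ (tp-≡⇒eval-≡ G H k φ (m⊔n≤o⇒m≤o _ _ d) e) (tp-≡⇒eval-≡ G H k ψ (m⊔n≤o⇒n≤o _ _ d) e)
  tp-≡⇒eval-≡ G H k (Or φ ψ) d e =
    cong₂ _∨_ (tp-≡⇒eval-≡ G H k φ (m⊔n≤o⇒m≤o _ _ d) e) (tp-≡⇒eval-≡ G H k ψ (m⊔n≤o⇒n≤o _ _ d) e)
  tp-≡⇒eval-≡ G H k (Imp φ ψ) d e =
    cong₂ (λ x y → not x ∨ y) (tp-≡⇒eval-≡ G H k φ (m⊔n≤o⇒m≤o _ _ d) e) (tp-≡⇒eval-≡ G H k ψ (m⊔n≤o⇒n≤o _ _ d) e)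
  tp-≡⇒eval-≡ G H k (Iff φ ψ) d e =
    cong₂ _⇔ᵇ_ (tp-≡⇒eval-≡ G H k φ (m⊔n≤o⇒m≤o _ _ d) e) (tp-≡⇒eval-≡ G H k ψ (m⊔n≤o⇒n≤o _ _ d) e)
  tp-≡⇒eval-≡ G H (suc k) (Exists φ) (s≤s d) e =
    T-injective (any-allFin-transfer (tp-≡⇒eval-forth G H φ d e))
                (any-allFin-transfer (tp-≡⇒eval-forth H G φ d (sym e)))
  tp-≡⇒eval-≡ G H (suc k) (Forall φ) (s≤s d) e =
    T-injective (all-allFin-transfer (tp-≡⇒eval-forth H G φ d (sym e)))
                (all-allFin-transfer (tp-≡⇒eval-forth G H φ d e))

  tp-≡⇒eval-forth : (G H : Graph) {k v : ℕ} {ρ : Fin v → Fin (n G)} {σ : Fin v → Fin (n H)}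
    (φ : Formula (suc v)) → depth φ ≤ k → tp G (suc k) ρ ≡ tp H (suc k) σ →
    ∀ a → ∃[ b ] eval G φ (extend a ρ) ≡ eval H φ (extend b σ)
  tp-≡⇒eval-forth G H {k} φ d e a with b , e′ ← tp-suc-≡⇒forth G H {k = k} e a =
    b , tp-≡⇒eval-≡ G H k φ d e′

sentenceType : (k : ℕ) → Graph → Fin (typeCount k 0)
sentenceType k G = tp G k noVars

definable⇒sentenceType-unique : ∀ {k G H} → D≤ G k → ¬ (G ≅ H) → sentenceType k G ≢ sentenceType k H
definable⇒sentenceType-unique {k} {G} {H} (φ , depthφ≤k , G⊨φ , onlyG) G≇H e =
  onlyG H G≇H (trans (sym (tp-≡⇒eval-≡ G H k φ depthφ≤k e)) G⊨φ)

definable-sentenceTypes-distinct : ∀ k {Gs : List Graph} → All (λ G → D≤ G k) Gs →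
  AllPairs (λ G H → ¬ (G ≅ H)) Gs → AllPairs (λ G H → sentenceType k G ≢ sentenceType k H) Gs
definable-sentenceTypes-distinct k []         []         = []
definable-sentenceTypes-distinct k (dG ∷ ds) (G≇ ∷ ps) =
  All.map (definable⇒sentenceType-unique dG) G≇ ∷ definable-sentenceTypes-distinct k ds ps

n<2^n : ∀ m → m < 2 ^ m
n<2^n zero    = s≤s z≤n
n<2^n (suc m) =
  subst (suc (suc m) ≤_) (cong (2 ^ m +_) (sym (+-identityʳ (2 ^ m)))) (+-mono-≤ (m^n>0 2 m) (n<2^n m))

2*n≤2^n : ∀ m → 2 * m ≤ 2 ^ m
2*n≤2^n zero    = z≤n
2*n≤2^n (suc m) = *-monoʳ-≤ 2 (n<2^n m)

4^n≤2^2^n : ∀ m → 4 ^ m ≤ 2 ^ 2 ^ m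
4^n≤2^2^n m = subst (_≤ 2 ^ 2 ^ m) (sym (^-*-assoc 2 2 m)) (^-monoʳ-≤ 2 (2*n≤2^n m))

symMatrixCount-4≤2^2^n : ∀ m → symMatrixCount 4 m ≤ 2 ^ 2 ^ m
symMatrixCount-4≤2^2^n zero    = s≤s z≤n
symMatrixCount-4≤2^2^n (suc m) = begin
  4 ^ m * symMatrixCount 4 m ≤⟨ *-mono-≤ (4^n≤2^2^n m) (symMatrixCount-4≤2^2^n m) ⟩
  2 ^ 2 ^ m * 2 ^ 2 ^ m      ≡⟨ sym (^-distribˡ-+-* 2 (2 ^ m) (2 ^ m)) ⟩
  2 ^ (2 ^ m + 2 ^ m)        ≡⟨ cong (λ x → 2 ^ (2 ^ m + x)) (sym (+-identityʳ (2 ^ m))) ⟩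
  2 ^ 2 ^ suc m              ∎
  where open ≤-Reasoning

typeCount≤Tower : ∀ j v t → typeCount 0 (v + j) ≤ Tower t → typeCount j v ≤ Tower (j + t)
typeCount≤Tower zero    v t h = subst (λ m → typeCount 0 m ≤ Tower t) (+-identityʳ v) h
typeCount≤Tower (suc j) v t h =
  ^-monoʳ-≤ 2 (typeCount≤Tower j (suc v) t (subst (λ m → typeCount 0 m ≤ Tower t) (+-suc v j) h))

n≤Tower[n] : ∀ m → m ≤ Tower m
n≤Tower[n] zero    = z≤n
n≤Tower[n] (suc m) = ≤-trans (s≤s (n≤Tower[n] m)) (n<2^n (Tower m))

search-correct : ∀ m f i → m ≤ Tower (i + f) → m ≤ Tower (search m f i)
search-correct m zero    i h = subst (λ j → m ≤ Tower j) (+-identityʳ i) h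
search-correct m (suc f) i h with m ≤? Tower i
... | yes m≤ = m≤
... | no _   = search-correct m f (suc i) (subst (λ j → m ≤ Tower j) (+-suc i f) h)

n≤Tower[logStar[n]] : ∀ m → m ≤ Tower (logStar m)
n≤Tower[logStar[n]] m = search-correct m m 0 (n≤Tower[n] m)

theorem2p3 : (k : ℕ) → 1 ≤ k → (Gs : List Graph) →
    All (λ G → D≤ G k) Gs → AllPairs (λ G H → ¬ (G ≅ H)) Gs →
    length Gs ≤ Tower (k + logStar k + 2)
theorem2p3 k _ Gs definable nonIso = begin
  length Gs                        ≡⟨ sym (length-map (sentenceType k) Gs) ⟩
  length (map (sentenceType k) Gs) ≤⟨ distinct⇒length≤ (map⁺ (definable-sentenceTypes-distinct k definable nonIso)) ⟩
  typeCount k 0                    ≤⟨ typeCount≤Tower k 0 (2 + L) atomicBound ⟩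
  Tower (k + (2 + L))              ≡⟨ cong Tower (trans (cong (k +_) (+-comm 2 L)) (sym (+-assoc k L 2))) ⟩
  Tower (k + L + 2)                ∎
  where
  open ≤-Reasoning
  L = logStar k
  atomicBound : symMatrixCount 4 k ≤ Tower (2 + L)
  atomicBound = ≤-trans (symMatrixCount-4≤2^2^n k) (^-monoʳ-≤ 2 (^-monoʳ-≤ 2 (n≤Tower[logStar[n]] k)))
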